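{- Let $F$ be a set functor that preserves intersections, equipped with a subnatural encoding $\flat_X\colon FX\to\mathcal{B}(A\times X)$. Then for every set $X$ and every $t\in FX$ we have $\tau^{\mathcal{B}(A\times-)}_X(\flat_X(t))\subseteq\tau^F_X(t)$.
   Context: $\mathcal{B}$ is the bag functor ($\mathcal{B}X$ = finitely supported maps $X\to\mathbb{N}$; $\mathcal{B}f(b)(y)=\sum_{f(x)=y}b(x)$). An encoding of $F$ is a label set $A$ with maps $\flat_X\colon FX\to\mathcal{B}(A\times X)$ such that $\langle F!,\flat_X\rangle\colon FX\to F1\times\mathcal{B}(A\times X)$ is injective for each set $X$; it is subnatural if $\mathcal{B}(A\times m)\circ\flat_X=\flat_Y\circ Fm$ for every injective $m\colon X\to Y$. $F$ preserves intersections if it maps pullbacks of pairs of injective maps to pullbacks. For a set functor $G$, a set $X$ and $t\in GX$, $\tau^G_X(t)=\{x\in X\mid t\notin Gi[G(X\setminus\{x\})]\}$, where $i\colon X\setminus\{x\}\hookrightarrow X$ is the inclusion; this is applied to $G=F$ and to $G=\mathcal{B}(A\times-)$. -}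

module Defs where

open import Data.Unit using (⊤; tt)
open import Data.Product using (Σ; ∃; _×_; _,_; proj₁; proj₂; map₂)
open import Data.List using (List; map)
open import Data.List.Relation.Binary.Permutation.Propositional using (_↭_)
open import Relation.Binary.PropositionalEquality using (_≡_; _≢_)
open import Relation.Nullary using (¬_)
open import Function using (id; _∘_)
open import Function.Definitions using (Injective)

record SetFunctor : Set₁ where
  field
    F₀     : Set → Set
    fmap   : {X Y : Set} → (X → Y) → F₀ X → F₀ Y
    fmap-id : {X : Set} (t : F₀ X) → fmap id t ≡ t
    fmap-∘  : {X Y Z : Set} (g : Y → Z) (f : X → Y) (t : F₀ X) →
              fmap (g ∘ f) t ≡ fmap g (fmap f t)

  F! : {X : Set} → F₀ X → F₀ ⊤
  F! = fmap (λ _ → tt)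

open SetFunctor public

-- Finite bags (finitely supported maps X → ℕ) are represented as finite
-- lists taken up to permutation (_↭_ is equality of bags).  The bag
-- functor acts by List.map, which agrees with B f (b)(y) = Σ_{f x = y} b x.
Bag : Set → Set
Bag X = List X

BA-map : (A : Set) {X Y : Set} → (X → Y) → Bag (A × X) → Bag (A × Y)
BA-map A f = map (map₂ f)

Pullback : {X Y Z : Set} → (X → Z) → (Y → Z) → Set
Pullback {X} {Y} m₁ m₂ = Σ (X × Y) λ p → m₁ (proj₁ p) ≡ m₂ (proj₂ p)

-- F preserves intersections: F maps the pullback of a pair of injective
-- maps to a pullback, i.e. the canonical map F P → {(u,v) | F m₁ u = F m₂ v}
-- is bijective.
PreservesIntersections : SetFunctor → Set₁
PreservesIntersections F =
  {X Y Z : Set} (m₁ : X → Z) (m₂ : Y → Z) →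
  Injective _≡_ _≡_ m₁ → Injective _≡_ _≡_ m₂ →
  ((u : F₀ F X) (v : F₀ F Y) → fmap F m₁ u ≡ fmap F m₂ v →
     Σ (F₀ F (Pullback m₁ m₂)) λ w →
       (fmap F (proj₁ ∘ proj₁) w ≡ u) × (fmap F (proj₂ ∘ proj₁) w ≡ v))
  ×
  ((w w′ : F₀ F (Pullback m₁ m₂)) →
     fmap F (proj₁ ∘ proj₁) w ≡ fmap F (proj₁ ∘ proj₁) w′ →
     fmap F (proj₂ ∘ proj₁) w ≡ fmap F (proj₂ ∘ proj₁) w′ →
     w ≡ w′)

record Encoding (F : SetFunctor) : Set₁ where
  field
    A : Set
    ♭ : {X : Set} → F₀ F X → Bag (A × X)
    -- ⟨F!, ♭_X⟩ : F X → F 1 × B(A × X) is injective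
    ♭-inj : {X : Set} (s t : F₀ F X) →
            F! F s ≡ F! F t → ♭ s ↭ ♭ t → s ≡ t

open Encoding public

Subnatural : {F : SetFunctor} → Encoding F → Set₁
Subnatural {F} E =
  {X Y : Set} (m : X → Y) → Injective _≡_ _≡_ m →
  (t : F₀ F X) → BA-map (A E) m (♭ E t) ↭ ♭ E (fmap F m t)

_∖₁_ : (X : Set) → X → Set
X ∖₁ x = Σ X λ y → y ≢ x

incl : {X : Set} {x : X} → X ∖₁ x → X
incl = proj₁

_∈τF[_]_ : {X : Set} → X → (F : SetFunctor) → F₀ F X → Set
_∈τF[_]_ {X} x F t = ¬ Σ (F₀ F (X ∖₁ x)) λ s → fmap F (incl {X} {x}) s ≡ t

_∈τB[_]_ : {X : Set} → X → (A : Set) → Bag (A × X) → Set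
_∈τB[_]_ {X} x A b = ¬ Σ (Bag (A × (X ∖₁ x))) λ c → BA-map A (incl {X} {x}) c ↭ b

{-# OPTIONS --safe #-}
-- If t = F i (s) for the inclusion i : X ∖ {x} ↪ X, then subnaturality of ♭
-- along i gives ♭ t ↭ B(A × i)(♭ s), so ♭ t also lies in the image of
-- B(A × i).  Contrapositively, x ∈ τ^B(♭ t) forces x ∈ τ^F(t).
module Submission where

open import Defs
open import Data.Empty using (⊥-elim-irr)
open import Data.Product using (_×_; _,_)
open import Data.List.Properties using (map-∘)
open import Data.List.Relation.Binary.Permutation.Propositional using (_↭_; ↭-reflexive; ↭-trans)
open import Relation.Binary.PropositionalEquality using (_≡_; _≢_; refl; sym; trans)
open import Function using (_∘_)
open import Function.Definitions using (Injective)

-- The inclusion incl : X ∖₁ x → X is not provably injective without function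
-- extensionality (the proofs of y ≢ x may differ), so subnaturality is applied
-- to this copy of X ∖ {x} whose proof field is irrelevant.
record _∖₁ⁱ_ (X : Set) (x : X) : Set where
  constructor _,ⁱ_
  field
    elem : X
    .avoids : elem ≢ x
open _∖₁ⁱ_

inclⁱ-injective : {X : Set} {x : X} → Injective _≡_ _≡_ (elem {X} {x})
inclⁱ-injective refl = refl

toⁱ : {X : Set} {x : X} → X ∖₁ x → X ∖₁ⁱ x
toⁱ (y , y≢x) = y ,ⁱ y≢x

fromⁱ : {X : Set} {x : X} → X ∖₁ⁱ x → X ∖₁ x
fromⁱ (y ,ⁱ y≢x) = y , λ y≡x → ⊥-elim-irr (y≢x y≡x)

BA-map-∘ : (A : Set) {X Y Z : Set} (g : Y → Z) (f : X → Y) (b : Bag (A × X)) →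
           BA-map A (g ∘ f) b ≡ BA-map A g (BA-map A f b)
BA-map-∘ A g f b = map-∘ b

♭-image : {F : SetFunctor} (E : Encoding F) → Subnatural E →
          {X Y : Set} (m : X → Y) → Injective _≡_ _≡_ m →
          (s : F₀ F X) {t : F₀ F Y} → fmap F m s ≡ t →
          BA-map (A E) m (♭ E s) ↭ ♭ E t
♭-image E sub m m-inj s refl = sub m m-inj s

τB⊆τF : {F : SetFunctor} (E : Encoding F) → Subnatural E →
        {X : Set} (t : F₀ F X) (x : X) →
        x ∈τB[ A E ] (♭ E t) → x ∈τF[ F ] t
τB⊆τF {F} E sub {X} t x x∈τB (s , incl-s≡t) = x∈τB (c , incl-c↭♭t)
  where
  sⁱ : F₀ F (X ∖₁ⁱ x)
  sⁱ = fmap F toⁱ s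

  inclⁱ-sⁱ≡t : fmap F elem sⁱ ≡ t
  inclⁱ-sⁱ≡t = trans (sym (fmap-∘ F elem toⁱ s)) incl-s≡t

  c : Bag (A E × (X ∖₁ x))
  c = BA-map (A E) fromⁱ (♭ E sⁱ)

  incl-c↭♭t : BA-map (A E) incl c ↭ ♭ E t
  incl-c↭♭t = ↭-trans (↭-reflexive (sym (BA-map-∘ (A E) incl fromⁱ (♭ E sⁱ))))
                      (♭-image E sub elem inclⁱ-injective sⁱ inclⁱ-sⁱ≡t)

proposition39 : (F : SetFunctor) → PreservesIntersections F →
    (E : Encoding F) → Subnatural E →
    {X : Set} (t : F₀ F X) (x : X) →
    x ∈τB[ A E ] (♭ E t) → x ∈τF[ F ] t
proposition39 F _ = τB⊆τF
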